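{- Let $(\mathcal{M},w)$ be a pointed $\Theta$-model with $\mathcal{M}=\langle W,\prec,V\rangle$, and let $\alpha,\beta\in W^{un}_w$ be such that $\alpha\mathrel{\prec^{un}_w}\beta$. Then there exist $\gamma\in W^{un}_w$, $m,n\ge0$ and (not necessarily pairwise distinct) $v_1,\dots,v_m\in W$, $u_1,\dots,u_n\in W$ such that $v_m\prec\dots\prec v_1\prec end(\gamma)\prec u_1\prec\dots\prec u_n$, $\alpha=\gamma^\frown(v_1,\dots,v_m)$ and $\beta=\gamma^\frown(u_1,\dots,u_n)$.
   Context: A $\Theta$-model is $\mathcal{M}=\langle W,\prec,V\rangle$, $W\ne\varnothing$, $\prec$ a partial order, $V$ a monotone valuation; $(\mathcal{M},w)$ pointed if $w\in W$. $W^{un}_w$ is the set of finite sequences $(u_1,\dots,u_n)$, $n\ge1$, of elements of $W$ with $u_1=w$ and, for $i<n$, $u_i\ne u_{i+1}$ and $u_i,u_{i+1}$ comparable under $\prec$. $\rho^{un}_w$ consists of pairs $(s,t)$ of elements of $W^{un}_w$ with, for some $(w_1,\dots,w_{n+1})$, either $s=(w_1,\dots,w_n)$, $t=(w_1,\dots,w_{n+1})$, $w_n\prec w_{n+1}$, or $s=(w_1,\dots,w_{n+1})$, $t=(w_1,\dots,w_n)$, $w_{n+1}\prec w_n$. $\prec^{un}_w$ is the reflexive and transitive closure of $\rho^{un}_w$. $end(\alpha)$ is the last element of $\alpha$; $^\frown$ is concatenation (with the empty tuple when $m=0$ or $n=0$). -}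

module Defs where

open import Data.List using (List; []; _∷_; _++_; [_])
open import Data.Product using (_×_; Σ; _,_; proj₁)
open import Data.Sum using (_⊎_)
open import Data.Unit using (⊤)
open import Relation.Binary.PropositionalEquality using (_≡_)
open import Relation.Binary.Structures using (IsPartialOrder)
open import Relation.Binary.Construct.Closure.ReflexiveTransitive using (Star)
open import Relation.Nullary using (¬_)

record ΘModel (Prp : Set) : Set₁ where
  field
    W         : Set
    inhabited : W
    _≺_       : W → W → Set
    isPO      : IsPartialOrder _≡_ _≺_
    V         : Prp → W → Set
    V-mono    : ∀ {p u v} → u ≺ v → V p u → V p v

endL : {A : Set} → A → List A → A
endL x []       = x
endL x (y ∷ ys) = endL y ys

module Unravel {Prp : Set} (M : ΘModel Prp) where
  open ΘModel M

  Comparable : W → W → Set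
  Comparable a b = (a ≺ b) ⊎ (b ≺ a)

  ChainOK : List W → Set
  ChainOK []           = ⊤
  ChainOK (a ∷ [])     = ⊤
  ChainOK (a ∷ b ∷ xs) = (¬ a ≡ b) × Comparable a b × ChainOK (b ∷ xs)

  -- W^un_w : finite sequences (u₁,…,uₙ), n ≥ 1, u₁ = w, consecutive entries
  -- distinct and comparable.  A sequence is represented as w ∷ xs.
  Wun : W → Set
  Wun w = Σ (List W) λ xs → ChainOK (w ∷ xs)

  seq : ∀ {w} → Wun w → List W
  seq {w} α = w ∷ proj₁ α

  end : ∀ {w} → Wun w → W
  end {w} α = endL w (proj₁ α)

  ρun : ∀ {w} → Wun w → Wun w → Set
  ρun s t = (Σ W λ x → seq t ≡ seq s ++ [ x ] × end s ≺ x)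
          ⊎ (Σ W λ x → seq s ≡ seq t ++ [ x ] × x ≺ end t)

  _≺un_ : ∀ {w} → Wun w → Wun w → Set
  _≺un_ {w} = Star (ρun {w})

  DescFrom : W → List W → Set
  DescFrom x []       = ⊤
  DescFrom x (v ∷ vs) = (v ≺ x) × DescFrom v vs

  AscFrom : W → List W → Set
  AscFrom x []       = ⊤
  AscFrom x (u ∷ us) = (x ≺ u) × AscFrom u us

module Submission where

open import Defs
open import Data.List using (List; []; _∷_; _++_; [_]; _∷ʳ_; initLast; _∷ʳ′_)
open import Data.List.Properties using (++-assoc; ++-identityʳ; ∷-injectiveʳ; ∷ʳ-injective)
open import Data.Product using (_×_; Σ; _,_; proj₁; proj₂)
open import Data.Sum using (inj₁; inj₂)
open import Data.Unit using (tt)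
open import Data.Empty using (⊥-elim)
open import Relation.Binary.PropositionalEquality
  using (_≡_; _≢_; refl; sym; trans; cong; subst; subst₂; module ≡-Reasoning)
open import Relation.Binary.Structures using (IsPartialOrder)
open import Relation.Binary.Construct.Closure.ReflexiveTransitive using (ε; _◅_)

-- Reading a path α ≺un β from α, a drop just lengthens the
-- descending tail of α, and an append can never meet a nonempty descending
-- tail: its last element would lie both above and below end α, so by
-- antisymmetry it would equal end α, against distinctness of consecutive
-- entries.  Hence an append always happens at the common prefix and extends
-- the ascending tail of β.

endL-++ : {A : Set} (x : A) (xs ys : List A) → endL x (xs ++ ys) ≡ endL (endL x xs) ys
endL-++ x []       ys = refl
endL-++ x (y ∷ xs) ys = endL-++ y xs ys

module _ {Prp : Set} (M : ΘModel Prp) where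
  open ΘModel M
  open Unravel M
  open IsPartialOrder isPO using (antisym)

  DescFrom-∷ʳ : ∀ {x v} vs → DescFrom x vs → v ≺ endL x vs → DescFrom x (vs ∷ʳ v)
  DescFrom-∷ʳ []       _         v≺x = v≺x , tt
  DescFrom-∷ʳ (u ∷ vs) (u≺x , d) v≺e = u≺x , DescFrom-∷ʳ vs d v≺e

  DescFrom-∷ʳ⁻ : ∀ {x v} vs → DescFrom x (vs ∷ʳ v) → v ≺ endL x vs
  DescFrom-∷ʳ⁻ []       (v≺x , _) = v≺x
  DescFrom-∷ʳ⁻ (u ∷ vs) (_ , d)   = DescFrom-∷ʳ⁻ vs d

  ChainOK-∷ʳ⇒endL≢ : ∀ {u x} xs → ChainOK ((u ∷ xs) ∷ʳ x) → endL u xs ≢ x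
  ChainOK-∷ʳ⇒endL≢ []       (u≢x , _)   = u≢x
  ChainOK-∷ʳ⇒endL≢ (y ∷ xs) (_ , _ , c) = ChainOK-∷ʳ⇒endL≢ xs c

  end-++ : ∀ {w} (α γ : Wun w) vs → seq α ≡ seq γ ++ vs → end α ≡ endL (end γ) vs
  end-++ {w} _ (g , _) vs eq = trans (cong (endL w) (∷-injectiveʳ eq)) (endL-++ w g vs)

  Fork : ∀ {w} → Wun w → Wun w → Set
  Fork {w} α β = Σ (Wun w) λ γ → Σ (List W) λ vs → Σ (List W) λ us →
    DescFrom (end γ) vs × AscFrom (end γ) us × seq α ≡ seq γ ++ vs × seq β ≡ seq γ ++ us

  Fork-refl : ∀ {w} (α : Wun w) → Fork α α
  Fork-refl α = α , [] , [] , tt , tt , sym (++-identityʳ (seq α)) , sym (++-identityʳ (seq α))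

  Fork-snoc-below : ∀ {w} {β : Wun w} {x} (α α′ : Wun w) →
                    seq α ≡ seq α′ ∷ʳ x → x ≺ end α′ → Fork α′ β → Fork α β
  Fork-snoc-below {x = x} α α′ α≡α′x x≺end (γ , vs , us , desc , asc , α′≡ , β≡) =
    γ , vs ∷ʳ x , us , DescFrom-∷ʳ vs desc (subst (x ≺_) (end-++ α′ γ vs α′≡) x≺end) , asc , α≡ , β≡
    where
      open ≡-Reasoning
      α≡ : seq α ≡ seq γ ++ vs ∷ʳ x
      α≡ = begin
        seq α                ≡⟨ α≡α′x ⟩
        seq α′ ∷ʳ x          ≡⟨ cong (_∷ʳ x) α′≡ ⟩
        (seq γ ++ vs) ∷ʳ x   ≡⟨ ++-assoc (seq γ) vs [ x ] ⟩
        seq γ ++ vs ∷ʳ x     ∎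

  snoc-above-has-no-descent : ∀ {w} {x} (α α′ γ : Wun w) vs →
                              seq α′ ≡ seq α ∷ʳ x → end α ≺ x →
                              seq α′ ≡ seq γ ++ vs → DescFrom (end γ) vs → vs ≡ []
  snoc-above-has-no-descent _ _ _ vs _ _ _ _ with initLast vs
  ... | [] = refl
  snoc-above-has-no-descent {x = x} α α′ γ _ α′≡αx end≺x α′≡ desc | vs ∷ʳ′ v =
    ⊥-elim (ChainOK-∷ʳ⇒endL≢ (proj₁ α) chain (antisym end≺x x≺end))
    where
      split : seq α ≡ seq γ ++ vs × x ≡ v
      split = ∷ʳ-injective (seq α) (seq γ ++ vs)
                (trans (sym α′≡αx) (trans α′≡ (sym (++-assoc (seq γ) vs [ v ]))))
      x≺end : x ≺ end α
      x≺end = subst₂ _≺_ (sym (proj₂ split)) (sym (end-++ α γ vs (proj₁ split))) (DescFrom-∷ʳ⁻ vs desc)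
      chain : ChainOK (seq α ∷ʳ x)
      chain = subst ChainOK α′≡αx (proj₂ α′)

  Fork-unsnoc-above : ∀ {w} {β : Wun w} {x} (α α′ : Wun w) →
                      seq α′ ≡ seq α ∷ʳ x → end α ≺ x → Fork α′ β → Fork α β
  Fork-unsnoc-above α α′ α′≡αx end≺x (γ , vs , us , desc , asc , α′≡ , β≡)
    with snoc-above-has-no-descent α α′ γ vs α′≡αx end≺x α′≡ desc
  Fork-unsnoc-above {β = β} {x} α _ α′≡αx end≺x (γ , _ , us , _ , asc , α′≡ , β≡γus) | refl =
    α , [] , x ∷ us , tt , (end≺x , subst (λ y → AscFrom y us) endγ≡x asc) ,
    sym (++-identityʳ (seq α)) , β≡
    where
      γ≡αx : seq γ ≡ seq α ∷ʳ x
      γ≡αx = trans (sym (++-identityʳ (seq γ))) (trans (sym α′≡) α′≡αx)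
      endγ≡x : end γ ≡ x
      endγ≡x = end-++ γ α [ x ] γ≡αx
      β≡ : seq β ≡ seq α ++ x ∷ us
      β≡ = trans β≡γus (trans (cong (_++ us) γ≡αx) (++-assoc (seq α) [ x ] us))

  ≺un⇒Fork : ∀ {w} {α β : Wun w} → α ≺un β → Fork α β
  ≺un⇒Fork {α = α} ε = Fork-refl α
  ≺un⇒Fork {α = α} {β} (_◅_ {j = α′} (inj₁ (_ , eq , end≺x)) steps) =
    Fork-unsnoc-above {β = β} α α′ eq end≺x (≺un⇒Fork steps)
  ≺un⇒Fork {α = α} {β} (_◅_ {j = α′} (inj₂ (_ , eq , x≺end)) steps) =
    Fork-snoc-below {β = β} α α′ eq x≺end (≺un⇒Fork steps)

lemma3p4 : {Prp : Set} (M : ΘModel Prp) (w : ΘModel.W M) →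
           let open ΘModel M in
           let open Unravel M in
           (α β : Wun w) → α ≺un β →
           Σ (Wun w) λ γ → Σ (List W) λ vs → Σ (List W) λ us →
             DescFrom (end γ) vs × AscFrom (end γ) us ×
             seq α ≡ seq γ ++ vs × seq β ≡ seq γ ++ us
lemma3p4 M w α β = ≺un⇒Fork M
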